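{- For any $\mathsf T$-term $P$ and any $*$-term $Q$, the unique $\mathsf T$-$*$-decomposition of $se(P\wedge Q)$ is $(se(P)[\mathsf T\mapsto\triangle],\,se(Q))$.
   Context: Closed terms over constants $\mathsf T,\mathsf F$, atoms $a\in A$ ($A$ non-empty), unary $\neg$ and binary $\wedge,\vee$. Grammar (with $a\in A$): $\mathsf T$-terms $P^{\mathsf T}::=\mathsf T\mid (a\wedge P^{\mathsf T})\vee P^{\mathsf T}$; $\mathsf F$-terms $P^{\mathsf F}::=\mathsf F\mid (a\vee P^{\mathsf F})\wedge P^{\mathsf F}$; $\ell$-terms $P^\ell::=(a\wedge P^{\mathsf T})\vee P^{\mathsf F}\mid(\neg a\wedge P^{\mathsf T})\vee P^{\mathsf F}$; $*$-terms $P^*::=P^c\mid P^d$, $P^c::=P^\ell\mid P^*\wedge P^d$, $P^d::=P^\ell\mid P^*\vee P^c$. $\mathcal T_A$: least set containing $\mathsf T,\mathsf F$ and $X\trianglelefteq a\trianglerighteq Y$ for $X,Y\in\mathcal T_A$, $a\in A$; $\mathcal T_{A,\triangle}$ likewise with leaves in $\{\mathsf T,\mathsf F,\triangle\}$. Depth: $d(\mathsf T)=d(\mathsf F)=0$, $d(Y\trianglelefteq a\trianglerighteq Z)=1+\max(d(Y),d(Z))$. Leaf replacement $X[\ell_1\mapsto Y_1,\dots]$ replaces every leaf $\ell_i$ of $X$ by $Y_i$. $se(\mathsf T)=\mathsf T$, $se(\mathsf F)=\mathsf F$, $se(a)=\mathsf T\trianglelefteq a\trianglerighteq\mathsf F$,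 $se(\neg P)=se(P)[\mathsf T\mapsto\mathsf F,\mathsf F\mapsto\mathsf T]$, $se(P\wedge Q)=se(P)[\mathsf T\mapsto se(Q)]$, $se(P\vee Q)=se(P)[\mathsf F\mapsto se(Q)]$. A pair $(Y,Z)\in\mathcal T_{A,\triangle}\times\mathcal T_A$ is a candidate $\mathsf T$-$*$-decomposition (ctsd) of $X\in\mathcal T_A$ if $X=Y[\triangle\mapsto Z]$, $Y$ contains neither $\mathsf T$ nor $\mathsf F$, $Z$ contains both $\mathsf T$ and $\mathsf F$, and there is no pair $(U,V)\in\mathcal T_{A,\triangle}\times\mathcal T_A$ with $Z=U[\triangle\mapsto V]$, $U$ containing $\triangle$, $U\neq\triangle$, and $U$ containing neither $\mathsf T$ nor $\mathsf F$. A $\mathsf T$-$*$-decomposition (tsd) of $X$ is a ctsd $(Y,Z)$ of $X$ such that there is no other ctsd $(Y',Z')$ of $X$ with $d(Z')<d(Z)$. -}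

module Defs where

open import Data.Nat using (ℕ; zero; suc; _⊔_; _<_)
open import Data.Product using (_×_; Σ; _,_)
open import Relation.Binary.PropositionalEquality using (_≡_)
open import Relation.Nullary using (¬_)

data Term (A : Set) : Set where
  `T `F : Term A
  atom  : A → Term A
  `¬_   : Term A → Term A
  _`∧_ _`∨_ : Term A → Term A → Term A

data IsTTerm {A : Set} : Term A → Set where
  t-T    : IsTTerm `T
  t-step : ∀ {P} (a : A) → IsTTerm P → ∀ {P'} → IsTTerm P' →
           IsTTerm ((atom a `∧ P) `∨ P')

data IsFTerm {A : Set} : Term A → Set where
  f-F    : IsFTerm `F
  f-step : ∀ {P} (a : A) → IsFTerm P → ∀ {P'} → IsFTerm P' →
           IsFTerm ((atom a `∨ P) `∧ P')

data IsLTerm {A : Set} : Term A → Set where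
  l-pos : ∀ (a : A) {P Q} → IsTTerm P → IsFTerm Q → IsLTerm ((atom a `∧ P) `∨ Q)
  l-neg : ∀ (a : A) {P Q} → IsTTerm P → IsFTerm Q → IsLTerm (((`¬ atom a) `∧ P) `∨ Q)

mutual
  data IsStarTerm {A : Set} : Term A → Set where
    s-c : ∀ {P} → IsCTerm P → IsStarTerm P
    s-d : ∀ {P} → IsDTerm P → IsStarTerm P

  data IsCTerm {A : Set} : Term A → Set where
    c-l : ∀ {P} → IsLTerm P → IsCTerm P
    c-∧ : ∀ {P Q} → IsStarTerm P → IsDTerm Q → IsCTerm (P `∧ Q)

  data IsDTerm {A : Set} : Term A → Set where
    d-l : ∀ {P} → IsLTerm P → IsDTerm P
    d-∨ : ∀ {P Q} → IsStarTerm P → IsCTerm Q → IsDTerm (P `∨ Q)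

data Tree (A L : Set) : Set where
  leaf : L → Tree A L
  node : Tree A L → A → Tree A L → Tree A L   -- node X a Y  =  X ⊴ a ⊵ Y

data Leaf : Set where
  T F : Leaf

data Leaf△ : Set where
  T F △ : Leaf△

𝒯 : Set → Set
𝒯 A = Tree A Leaf

𝒯△ : Set → Set
𝒯△ A = Tree A Leaf△

replace : ∀ {A L M} → Tree A L → (L → Tree A M) → Tree A M
replace (leaf l) f = f l
replace (node X a Y) f = node (replace X f) a (replace Y f)

depth : ∀ {A L} → Tree A L → ℕ
depth (leaf _) = 0
depth (node Y _ Z) = suc (depth Y ⊔ depth Z)

data Contains {A L : Set} (ℓ : L) : Tree A L → Set where
  here  : Contains ℓ (leaf ℓ)
  left  : ∀ {X a Y} → Contains ℓ X → Contains ℓ (node X a Y)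
  right : ∀ {X a Y} → Contains ℓ Y → Contains ℓ (node X a Y)

[T↦_,F↦_] : ∀ {A} → 𝒯 A → 𝒯 A → Leaf → 𝒯 A
[T↦ Y ,F↦ Z ] T = Y
[T↦ Y ,F↦ Z ] F = Z

[△↦_] : ∀ {A} → 𝒯 A → Leaf△ → 𝒯 A
[△↦ Z ] T = leaf T
[△↦ Z ] F = leaf F
[△↦ Z ] △ = Z

T↦△ : ∀ {A} → Leaf → 𝒯△ A
T↦△ T = leaf △
T↦△ F = leaf F

se : ∀ {A} → Term A → 𝒯 A
se `T = leaf T
se `F = leaf F
se (atom a) = node (leaf T) a (leaf F)
se (`¬ P) = replace (se P) [T↦ leaf F ,F↦ leaf T ]
se (P `∧ Q) = replace (se P) [T↦ se Q ,F↦ leaf F ]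
se (P `∨ Q) = replace (se P) [T↦ leaf T ,F↦ se Q ]

IsCTSD : ∀ {A} → 𝒯 A → 𝒯△ A → 𝒯 A → Set
IsCTSD {A} X Y Z =
  (X ≡ replace Y [△↦ Z ]) ×
  (¬ Contains T Y) × (¬ Contains F Y) ×
  Contains T Z × Contains F Z ×
  (¬ Σ (𝒯△ A) λ U → Σ (𝒯 A) λ V →
      (Z ≡ replace U [△↦ V ]) × Contains △ U × ¬ (U ≡ leaf △) ×
      ¬ Contains T U × ¬ Contains F U)

IsTSD : ∀ {A} → 𝒯 A → 𝒯△ A → 𝒯 A → Set
IsTSD {A} X Y Z =
  IsCTSD X Y Z ×
  (¬ Σ (𝒯△ A) λ Y' → Σ (𝒯 A) λ Z' → IsCTSD X Y' Z' × depth Z' < depth Z)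

-- Writing Z₀ = se Q, the tree se (P ∧ Q) is se P with every T-leaf replaced by Z₀, and se P has
-- only T-leaves, so (se P [T ↦ △], Z₀) is a candidate decomposition once Z₀ contains T and F and
-- admits no proper factorisation Z₀ = U[△ ↦ V].  The latter holds because Z₀ is indecomposable:
-- its two subtrees have no common tile.  This is true of every ℓ-term (its subtrees are uniformly
-- T and uniformly F) and survives the substitutions by which ∧ and ∨ build *-terms, since
-- replacing one leaf by an indecomposable tree containing that leaf is injective and reflects
-- tilings.  Candidate decompositions with indecomposable second component are unique, so this
-- one is also the T-*-decomposition.
module Submission where

open import Defs
open import Data.Empty using (⊥; ⊥-elim)
open import Data.Nat using (_≤_; s≤s)
open import Data.Nat.Properties using (m≤m⊔n; m≤n⊔m; ≤-trans; n≤1+n; <-irrefl; ≤-reflexive; <⇒≱)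
open import Data.Product using (_×_; Σ; ∃; _,_; proj₁; proj₂)
open import Data.Sum using (_⊎_; inj₁; inj₂)
open import Relation.Binary.PropositionalEquality
  using (_≡_; _≢_; refl; sym; trans; cong; cong₂; subst)
open import Relation.Nullary using (¬_)

node-injective : ∀ {A L} {X Y X' Y' : Tree A L} {a b : A} →
  node X a Y ≡ node X' b Y' → X ≡ X' × a ≡ b × Y ≡ Y'
node-injective refl = refl , refl , refl

leaf≢node : ∀ {A L} {l : L} {X Y : Tree A L} {a : A} → leaf l ≢ node X a Y
leaf≢node ()

replace-cong : ∀ {A L M} (X : Tree A L) {f g : L → Tree A M} →
  (∀ l → f l ≡ g l) → replace X f ≡ replace X g
replace-cong (leaf l) f≗g = f≗g l
replace-cong (node X a Y) f≗g = cong₂ (λ L R → node L a R) (replace-cong X f≗g) (replace-cong Y f≗g)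

replace-replace : ∀ {A L M N} (X : Tree A L) (f : L → Tree A M) (g : M → Tree A N) →
  replace (replace X f) g ≡ replace X (λ l → replace (f l) g)
replace-replace (leaf l) f g = refl
replace-replace (node X a Y) f g = cong₂ (λ L R → node L a R) (replace-replace X f g) (replace-replace Y f g)

contains-leaf : ∀ {A L} {l m : L} → Contains {A} l (leaf m) → l ≡ m
contains-leaf here = refl

contains-replace : ∀ {A L M} {l : L} {m : M} {X : Tree A L} {f : L → Tree A M} →
  Contains l X → Contains m (f l) → Contains m (replace X f)
contains-replace here c = c
contains-replace (left p) c = left (contains-replace p c)
contains-replace (right p) c = right (contains-replace p c)

some-leaf : ∀ {A L} (X : Tree A L) → ∃ λ l → Contains l X
some-leaf (leaf l) = l , here
some-leaf (node X _ _) with some-leaf X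
... | l , c = l , left c

data Uniform {A L : Set} (l : L) : Tree A L → Set where
  leaf : Uniform l (leaf l)
  node : ∀ {X a Y} → Uniform l X → Uniform l Y → Uniform l (node X a Y)

uniform-contains : ∀ {A L} {l m : L} {X : Tree A L} → Uniform l X → Contains m X → m ≡ l
uniform-contains leaf here = refl
uniform-contains (node u _) (left c) = uniform-contains u c
uniform-contains (node _ u) (right c) = uniform-contains u c

contains-uniform : ∀ {A L} {l : L} {X : Tree A L} → Uniform l X → Contains l X
contains-uniform leaf = here
contains-uniform (node u _) = left (contains-uniform u)

replace-uniform : ∀ {A L M} {l : L} {m : M} {X : Tree A L} {f : L → Tree A M} →
  Uniform l X → Uniform m (f l) → Uniform m (replace X f)
replace-uniform leaf u = u
replace-uniform (node u₁ u₂) u = node (replace-uniform u₁ u) (replace-uniform u₂ u)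

uniform-△ : ∀ {A} (U : 𝒯△ A) → ¬ Contains T U → ¬ Contains F U → Uniform △ U
uniform-△ (leaf T) ¬T _ = ⊥-elim (¬T here)
uniform-△ (leaf F) _ ¬F = ⊥-elim (¬F here)
uniform-△ (leaf △) _ _ = leaf
uniform-△ (node U₁ _ U₂) ¬T ¬F =
  node (uniform-△ U₁ (λ c → ¬T (left c)) (λ c → ¬F (left c)))
       (uniform-△ U₂ (λ c → ¬T (right c)) (λ c → ¬F (right c)))

uniform-△-only : ∀ {A} {U : 𝒯△ A} → Uniform △ U → ¬ Contains T U × ¬ Contains F U
uniform-△-only u = (λ c → T≢△ (uniform-contains u c)) , (λ c → F≢△ (uniform-contains u c))
  where
  T≢△ : T ≢ △
  T≢△ ()
  F≢△ : F ≢ △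
  F≢△ ()

-- Z = U[△ ↦ V] with U a △-only context exactly when Tiles V Z; so a proper factorisation of a
-- node Z tiles both of its subtrees by the same V.
data Tiles {A L : Set} (V : Tree A L) : Tree A L → Set where
  tile : Tiles V V
  node : ∀ {X a Y} → Tiles V X → Tiles V Y → Tiles V (node X a Y)

tiles-uniform : ∀ {A L} {l : L} {V X : Tree A L} → Tiles V X → Uniform l X → Uniform l V
tiles-uniform tile u = u
tiles-uniform (node t _) (node u _) = tiles-uniform t u

uniform-tiles : ∀ {A} {U : 𝒯△ A} (V : 𝒯 A) → Uniform △ U → Tiles V (replace U [△↦ V ])
uniform-tiles V leaf = tile
uniform-tiles V (node u₁ u₂) = node (uniform-tiles V u₁) (uniform-tiles V u₂)

Indecomposable : ∀ {A L} → Tree A L → Set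
Indecomposable (leaf _) = ⊥
Indecomposable {A} {L} (node X _ Y) = ¬ Σ (Tree A L) λ V → Tiles V X × Tiles V Y

uniform-node-indecomposable : ∀ {A L} {l m : L} {X Y : Tree A L} {a : A} →
  l ≢ m → Uniform l X → Uniform m Y → Indecomposable (node X a Y)
uniform-node-indecomposable l≢m uX uY (V , tX , tY) with some-leaf V
... | k , c = l≢m (trans (sym (uniform-contains (tiles-uniform tX uX) c))
                         (uniform-contains (tiles-uniform tY uY) c))

module Substitution {A L : Set} (σ : L → Tree A L) (l₀ : L) (W : Tree A L)
  (W-indecomposable : Indecomposable W) (W-contains-l₀ : Contains l₀ W)
  (σ-view : ∀ l → (l ≡ l₀ × σ l ≡ W) ⊎ (l ≢ l₀ × σ l ≡ leaf l)) where

  W≢leaf : ∀ {l} → W ≢ leaf l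
  W≢leaf e = subst Indecomposable e W-indecomposable

  depth-≤ : ∀ Y → Contains l₀ (replace Y σ) → depth W ≤ depth (replace Y σ)
  depth-≤ (leaf l) c with σ-view l
  ... | inj₁ (_ , σl≡W) = ≤-reflexive (cong depth (sym σl≡W))
  ... | inj₂ (l≢l₀ , σl≡l) = ⊥-elim (l≢l₀ (sym (contains-leaf (subst (Contains l₀) σl≡l c))))
  depth-≤ (node Y₁ _ Y₂) (left c) = ≤-trans (depth-≤ Y₁ c) (≤-trans (m≤m⊔n _ _) (n≤1+n _))
  depth-≤ (node Y₁ _ Y₂) (right c) = ≤-trans (depth-≤ Y₂ c) (≤-trans (m≤n⊔m _ _) (n≤1+n _))

  -- The subtree holding l₀ would contain a copy of W, yet be shallower than W.
  W≢node : ∀ Y₁ b Y₂ → W ≢ node (replace Y₁ σ) b (replace Y₂ σ)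
  W≢node Y₁ b Y₂ eq with subst (Contains l₀) eq W-contains-l₀ | cong depth eq
  ... | left c | depth-W = <⇒≱ (≤-trans (s≤s (m≤m⊔n _ _)) (≤-reflexive (sym depth-W))) (depth-≤ Y₁ c)
  ... | right c | depth-W = <⇒≱ (≤-trans (s≤s (m≤n⊔m _ _)) (≤-reflexive (sym depth-W))) (depth-≤ Y₂ c)

  replace-injective : ∀ X Y → replace X σ ≡ replace Y σ → X ≡ Y
  replace-injective (leaf l) (leaf m) eq with σ-view l | σ-view m
  ... | inj₁ (l≡l₀ , _) | inj₁ (m≡l₀ , _) = cong leaf (trans l≡l₀ (sym m≡l₀))
  ... | inj₁ (_ , σl≡W) | inj₂ (_ , σm≡m) = ⊥-elim (W≢leaf (trans (sym σl≡W) (trans eq σm≡m)))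
  ... | inj₂ (_ , σl≡l) | inj₁ (_ , σm≡W) = ⊥-elim (W≢leaf (trans (sym σm≡W) (trans (sym eq) σl≡l)))
  ... | inj₂ (_ , σl≡l) | inj₂ (_ , σm≡m) = trans (sym σl≡l) (trans eq σm≡m)
  replace-injective (leaf l) (node Y₁ b Y₂) eq with σ-view l
  ... | inj₁ (_ , σl≡W) = ⊥-elim (W≢node Y₁ b Y₂ (trans (sym σl≡W) eq))
  ... | inj₂ (_ , σl≡l) = ⊥-elim (leaf≢node (trans (sym σl≡l) eq))
  replace-injective (node X₁ a X₂) (leaf l) eq =
    sym (replace-injective (leaf l) (node X₁ a X₂) (sym eq))
  replace-injective (node X₁ a X₂) (node Y₁ b Y₂) eq with node-injective eq
  ... | e₁ , refl , e₂ =
    cong₂ (λ L R → node L a R) (replace-injective X₁ Y₁ e₁) (replace-injective X₂ Y₂ e₂)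

  same-tile : ∀ {V X₁ X₂ Y} → V ≡ replace X₁ σ → V ≡ replace X₂ σ → Tiles X₂ Y → Tiles X₁ Y
  same-tile {Y = Y} e₁ e₂ = subst (λ t → Tiles t Y) (sym (replace-injective _ _ (trans (sym e₁) e₂)))

  tiles-reflect : ∀ {V Z} X → Tiles V Z → Z ≡ replace X σ →
    ∃ λ X' → V ≡ replace X' σ × Tiles X' X
  tiles-reflect X tile eq = X , eq , tile
  tiles-reflect (leaf l) (node t₁ t₂) eq with σ-view l
  ... | inj₁ (_ , σl≡W) =
    ⊥-elim (subst Indecomposable (trans (sym σl≡W) (sym eq)) W-indecomposable (_ , t₁ , t₂))
  ... | inj₂ (_ , σl≡l) = ⊥-elim (leaf≢node (trans (sym σl≡l) (sym eq)))
  tiles-reflect (node X₁ _ X₂) (node t₁ t₂) eq with node-injective eq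
  ... | e₁ , refl , e₂ with tiles-reflect X₁ t₁ e₁ | tiles-reflect X₂ t₂ e₂
  ... | X₁' , V≡₁ , s₁ | X₂' , V≡₂ , s₂ = X₁' , V≡₁ , node s₁ (same-tile V≡₁ V≡₂ s₂)

  replace-indecomposable : ∀ Y → Indecomposable Y → Indecomposable (replace Y σ)
  replace-indecomposable (node Y₁ _ Y₂) indec (V , t₁ , t₂)
    with tiles-reflect Y₁ t₁ refl | tiles-reflect Y₂ t₂ refl
  ... | X₁ , V≡₁ , s₁ | X₂ , V≡₂ , s₂ = indec (X₁ , s₁ , same-tile V≡₁ V≡₂ s₂)

record Admissible {A : Set} (Z : 𝒯 A) : Set where
  field
    indecomposable : Indecomposable Z
    hasT : Contains T Z
    hasF : Contains F Z

open Admissible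

admissible-∧ : ∀ {A} {X W : 𝒯 A} → Admissible X → Admissible W →
  Admissible (replace X [T↦ W ,F↦ leaf F ])
admissible-∧ {X = X} {W} aX aW = record
  { indecomposable = Substitution.replace-indecomposable [T↦ W ,F↦ leaf F ] T W
      (indecomposable aW) (hasT aW) view X (indecomposable aX)
  ; hasT = contains-replace (hasT aX) (hasT aW)
  ; hasF = contains-replace (hasF aX) here
  }
  where
  view : ∀ l → (l ≡ T × [T↦ W ,F↦ leaf F ] l ≡ W) ⊎ (l ≢ T × [T↦ W ,F↦ leaf F ] l ≡ leaf l)
  view T = inj₁ (refl , refl)
  view F = inj₂ ((λ ()) , refl)

admissible-∨ : ∀ {A} {X W : 𝒯 A} → Admissible X → Admissible W →
  Admissible (replace X [T↦ leaf T ,F↦ W ])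
admissible-∨ {X = X} {W} aX aW = record
  { indecomposable = Substitution.replace-indecomposable [T↦ leaf T ,F↦ W ] F W
      (indecomposable aW) (hasF aW) view X (indecomposable aX)
  ; hasT = contains-replace (hasT aX) here
  ; hasF = contains-replace (hasF aX) (hasF aW)
  }
  where
  view : ∀ l → (l ≡ F × [T↦ leaf T ,F↦ W ] l ≡ W) ⊎ (l ≢ F × [T↦ leaf T ,F↦ W ] l ≡ leaf l)
  view T = inj₂ ((λ ()) , refl)
  view F = inj₁ (refl , refl)

se-uniform-T : ∀ {A} {P : Term A} → IsTTerm P → Uniform T (se P)
se-uniform-T t-T = leaf
se-uniform-T (t-step _ p p') = node (replace-uniform (se-uniform-T p) leaf) (se-uniform-T p')

se-uniform-F : ∀ {A} {P : Term A} → IsFTerm P → Uniform F (se P)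
se-uniform-F f-F = leaf
se-uniform-F (f-step _ p p') = node (se-uniform-F p') (replace-uniform (se-uniform-F p) leaf)

admissible-ℓ : ∀ {A} {P : Term A} → IsLTerm P → Admissible (se P)
admissible-ℓ (l-pos a {P} {Q} p q) = record
  { indecomposable = uniform-node-indecomposable {a = a} (λ ()) uT uF
  ; hasT = left (contains-uniform uT)
  ; hasF = right (contains-uniform uF)
  }
  where
  uT : Uniform T (replace (se P) [T↦ leaf T ,F↦ se Q ])
  uT = replace-uniform (se-uniform-T p) leaf
  uF : Uniform F (se Q)
  uF = se-uniform-F q
admissible-ℓ (l-neg a {P} {Q} p q) = record
  { indecomposable = uniform-node-indecomposable {a = a} (λ ()) uF uT
  ; hasT = right (contains-uniform uT)
  ; hasF = left (contains-uniform uF)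
  }
  where
  uT : Uniform T (replace (se P) [T↦ leaf T ,F↦ se Q ])
  uT = replace-uniform (se-uniform-T p) leaf
  uF : Uniform F (se Q)
  uF = se-uniform-F q

mutual
  admissible-* : ∀ {A} {P : Term A} → IsStarTerm P → Admissible (se P)
  admissible-* (s-c c) = admissible-c c
  admissible-* (s-d d) = admissible-d d

  admissible-c : ∀ {A} {P : Term A} → IsCTerm P → Admissible (se P)
  admissible-c (c-l ℓ) = admissible-ℓ ℓ
  admissible-c (c-∧ p d) = admissible-∧ (admissible-* p) (admissible-d d)

  admissible-d : ∀ {A} {P : Term A} → IsDTerm P → Admissible (se P)
  admissible-d (d-l ℓ) = admissible-ℓ ℓ
  admissible-d (d-∨ p c) = admissible-∨ (admissible-* p) (admissible-c c)

NoProperFactor : ∀ {A} → 𝒯 A → Set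
NoProperFactor {A} Z = ¬ Σ (𝒯△ A) λ U → Σ (𝒯 A) λ V →
  (Z ≡ replace U [△↦ V ]) × Contains △ U × ¬ (U ≡ leaf △) × ¬ Contains T U × ¬ Contains F U

indecomposable-noProperFactor : ∀ {A} {Z : 𝒯 A} → Indecomposable Z → NoProperFactor Z
indecomposable-noProperFactor _ (leaf T , _ , _ , _ , _ , ¬T , _) = ¬T here
indecomposable-noProperFactor _ (leaf F , _ , _ , _ , _ , _ , ¬F) = ¬F here
indecomposable-noProperFactor _ (leaf △ , _ , _ , _ , U≢△ , _) = U≢△ refl
indecomposable-noProperFactor indec (U@(node _ _ _) , V , refl , _ , _ , ¬T , ¬F)
  with uniform-△ U ¬T ¬F
... | node u₁ u₂ = indec (V , uniform-tiles V u₁ , uniform-tiles V u₂)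

plug-injective : ∀ {A} {Y Y' : 𝒯△ A} {Z Z' : 𝒯 A} → Uniform △ Y → Uniform △ Y' →
  NoProperFactor Z → NoProperFactor Z' → replace Y [△↦ Z ] ≡ replace Y' [△↦ Z' ] →
  Y ≡ Y' × Z ≡ Z'
plug-injective leaf leaf _ _ eq = refl , eq
plug-injective leaf u'@(node _ _) nZ _ eq =
  ⊥-elim (nZ (_ , _ , eq , contains-uniform u' , (λ ()) , uniform-△-only u'))
plug-injective u@(node _ _) leaf _ nZ' eq =
  ⊥-elim (nZ' (_ , _ , sym eq , contains-uniform u , (λ ()) , uniform-△-only u))
plug-injective (node u₁ u₂) (node u₁' u₂') nZ nZ' eq with node-injective eq
... | e₁ , refl , e₂ with plug-injective u₁ u₁' nZ nZ' e₁ | plug-injective u₂ u₂' nZ nZ' e₂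
... | Y₁≡ , Z≡ | Y₂≡ , _ = cong₂ (λ L R → node L _ R) Y₁≡ Y₂≡ , Z≡

ctsd-unique : ∀ {A} {X Z Z' : 𝒯 A} {Y Y' : 𝒯△ A} →
  IsCTSD X Y Z → IsCTSD X Y' Z' → Y ≡ Y' × Z ≡ Z'
ctsd-unique {Y = Y} {Y'} (e , ¬T , ¬F , _ , _ , nZ) (e' , ¬T' , ¬F' , _ , _ , nZ') =
  plug-injective (uniform-△ Y ¬T ¬F) (uniform-△ Y' ¬T' ¬F') nZ nZ' (trans (sym e) e')

ctsd⇒tsd : ∀ {A} {X Z : 𝒯 A} {Y : 𝒯△ A} → IsCTSD X Y Z → IsTSD X Y Z
ctsd⇒tsd c = c , λ (_ , _ , c' , Z'<Z) → <-irrefl (cong depth (sym (proj₂ (ctsd-unique c c')))) Z'<Z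

admissible-ctsd : ∀ {A} {X Z : 𝒯 A} {Y : 𝒯△ A} →
  X ≡ replace Y [△↦ Z ] → Uniform △ Y → Admissible Z → IsCTSD X Y Z
admissible-ctsd eq uY aZ =
  eq , proj₁ (uniform-△-only uY) , proj₂ (uniform-△-only uY) , hasT aZ , hasF aZ ,
  indecomposable-noProperFactor (indecomposable aZ)

se-∧-plug : ∀ {A} (P Q : Term A) → se (P `∧ Q) ≡ replace (replace (se P) T↦△) [△↦ se Q ]
se-∧-plug P Q = sym (trans (replace-replace (se P) T↦△ [△↦ se Q ])
                           (replace-cong (se P) λ { T → refl ; F → refl }))

theorem3p10 : {A : Set} → A → (P Q : Term A) → IsTTerm P → IsStarTerm Q →
    IsTSD (se (P `∧ Q)) (replace (se P) T↦△) (se Q) ×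
    (∀ Y Z → IsTSD (se (P `∧ Q)) Y Z → (Y ≡ replace (se P) T↦△) × (Z ≡ se Q))
theorem3p10 _ P Q tP sQ = ctsd⇒tsd ctsd , λ _ _ tsd → ctsd-unique (proj₁ tsd) ctsd
  where
  ctsd : IsCTSD (se (P `∧ Q)) (replace (se P) T↦△) (se Q)
  ctsd = admissible-ctsd (se-∧-plug P Q) (replace-uniform (se-uniform-T tP) leaf) (admissible-* sQ)
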